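{- Let \[ h(q) := \sum_{n=1}^{\infty} \frac{(-1)^{n+1} q^{n(n+1)/2}}{1-q^n}. \] Then, as formal power series in $q$, \[ h(q)-2h(q^2)=\sum_{n=1}^\infty (-1)^{n+1}q^{n^2} \Bigl( 1+2\sum_{i=1}^{n-1}(-1)^i q^{in} + (-1)^nq^{n^2} \Bigr), \] i.e. the $n$-th summand is $(-1)^{n+1}q^{n^2}(1-2q^n+2q^{2n}-\cdots+(-1)^{n-1}2q^{n^2-n}+(-1)^nq^{n^2})$. -}

module Defs where

open import Data.Nat as ℕ using (ℕ; zero; suc; _∸_; _≤?_)
open import Data.Nat.Divisibility using (_∣?_)
open import Data.Integer as ℤ using (ℤ; +_; -_)
open import Relation.Nullary.Decidable using (does)
open import Data.Bool using (if_then_else_)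
open import Relation.Binary.PropositionalEquality using (_≡_)

FPS : Set
FPS = ℕ → ℤ

infix 4 _≈_
_≈_ : FPS → FPS → Set
f ≈ g = ∀ m → f m ≡ g m

Σℤ≤ : ℕ → (ℕ → ℤ) → ℤ
Σℤ≤ zero    a = a zero
Σℤ≤ (suc n) a = Σℤ≤ n a ℤ.+ a (suc n)

X^ : ℕ → FPS
X^ k m = if does (m ℕ.≟ k) then + 1 else + 0

const : ℤ → FPS
const c zero    = c
const c (suc _) = + 0

infixl 6 _⊕_ _⊖_
infixl 7 _⊛_ _·_
_⊕_ : FPS → FPS → FPS
(f ⊕ g) m = f m ℤ.+ g m

_⊖_ : FPS → FPS → FPS
(f ⊖ g) m = f m ℤ.- g m

_·_ : ℤ → FPS → FPS
(c · f) m = c ℤ.* f m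

_⊛_ : FPS → FPS → FPS
(f ⊛ g) m = Σℤ≤ m (λ i → f i ℤ.* g (m ∸ i))

-- finite sum of series  Σ_{i=a}^{b} F i  (zero if b < a)
ΣFin : ℕ → ℕ → (ℕ → FPS) → FPS
ΣFin a b F m = go (suc b ∸ a)
  where
  go : ℕ → ℤ
  go zero    = + 0
  go (suc k) = go k ℤ.+ F (a ℕ.+ k) m

-- Infinite sum  Σ_{k=0}^{∞} F k  for a family with ord (F k) ≥ k
-- (coefficient of q^m is  Σ_{k=0}^{m} (F k) m; all later terms vanish there).
-- It is only applied below to families satisfying this order condition.
Σ∞ : (ℕ → FPS) → FPS
Σ∞ F m = Σℤ≤ m (λ k → F k m)

sgn : ℕ → ℤ
sgn zero    = + 1
sgn (suc k) = - sgn k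

-- 1/(1 - q^n) for n ≥ 1, i.e. the geometric series Σ_{k≥0} q^{n k}
-- (term k has order n·k ≥ k since n ≥ 1).
geom : (n : ℕ) → FPS
geom n = Σ∞ (λ k → X^ (n ℕ.* k))

sub2 : FPS → FPS
sub2 f m = if does (2 ∣? m) then f (m ℕ./ 2) else + 0

tri : ℕ → ℕ
tri zero    = zero
tri (suc n) = suc n ℕ.+ tri n

-- h(q) = Σ_{n≥1} (-1)^{n+1} q^{n(n+1)/2} / (1 - q^n);
-- the term with n = k+1 has order (k+1)(k+2)/2 ≥ k.
h : FPS
h = Σ∞ (λ k → let n = suc k in sgn (suc n) · (X^ (tri n) ⊛ geom n))

rhsTerm : ℕ → FPS
rhsTerm n = sgn (suc n) · (X^ (n ℕ.* n) ⊛
              (const (+ 1)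
               ⊕ (+ 2) · ΣFin 1 (n ∸ 1) (λ i → sgn i · X^ (i ℕ.* n))
               ⊕ sgn n · X^ (n ℕ.* n)))

-- Σ_{n≥1} rhsTerm n; the term with n = k+1 has order (k+1)² ≥ k.
rhs : FPS
rhs = Σ∞ (λ k → rhsTerm (suc k))

-- Both sides are compared coefficientwise, each coefficient being written as a sum over the
-- factorisations m = a b with a, b ≥ 1,  divSum m G = Σ_{ab=m} G a b.
-- * Expanding 1/(1 - q^n), the coefficient of q^M in h counts the pairs (n, K) with M = n(n+1)/2 + n K,
--   i.e. the factorisations 2 M = n d with n < d of opposite parities, weighted by (-1)^(n+1) (weight F).
--   Splitting them by which factor is even gives  [q^m] (h - 2 h(q²)) = Σ_{ab=m} Λ a b  with
--   Λ a b = F a (2 b) + F (2 a) b - 2 F a b.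
-- * The n-th summand on the right contributes a weight r n e ∈ {±1, ±2} at each factorisation m = n e
--   with n ≤ e ≤ 2 n, so  [q^m] rhs = Σ_{ab=m} r a b.
-- * Λ and r differ pointwise, but after symmetrising in (a, b) they agree up to a correction E whose
--   factorisation sum vanishes (it pairs (2 a', b) with b even against (a, 2 b') with a even).  The
--   identity  Λ a b + Λ b a = r a b + r b a + E a b  only depends on the parities of a, b and on the
--   position of b relative to a/2, a, 2 a, and is checked by a finite table.
module Submission where

open import Defs
open import Data.Nat as ℕ using (ℕ; zero; suc; _≤_; _<_; z≤n; s≤s; _≟_; _∸_; parity)
import Data.Nat.Properties as ℕP
import Data.Nat.Tactic.RingSolver as ℕSolver
open import Data.Integer as ℤ using (ℤ; +_; -_; -[1+_])
import Data.Integer.Properties as ℤP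
open import Data.Integer.Tactic.RingSolver using (solve-∀)
open import Data.Parity as ℙ using (Parity; 0ℙ; 1ℙ; _⁻¹)
import Data.Parity.Properties as ℙP
open import Data.Bool using (Bool; true; false; if_then_else_; T)
open import Data.Unit using (tt)
open import Data.Product using (_,_; _×_; proj₂)
open import Data.Sum using (inj₁; inj₂)
open import Relation.Binary.Definitions using (tri<; tri≈; tri>)
open import Data.Nat.Divisibility using (_∣_; _∣?_; divides; m∣m*n)
open import Data.Nat.DivMod using (m*n/n≡m)
open import Relation.Binary.PropositionalEquality
open import Relation.Nullary using (¬_; does; yes; no)
open import Relation.Nullary.Decidable using (dec-true; dec-false)

Σ< : ℕ → (ℕ → ℤ) → ℤ
Σ< zero    f = + 0
Σ< (suc n) f = Σ< n f ℤ.+ f n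

Σℤ≤≡Σ< : ∀ m f → Σℤ≤ m f ≡ Σ< (suc m) f
Σℤ≤≡Σ< zero    f = sym (ℤP.+-identityˡ (f 0))
Σℤ≤≡Σ< (suc m) f = cong (ℤ._+ f (suc m)) (Σℤ≤≡Σ< m f)

Σ<-cong : ∀ n {f g} → (∀ i → i < n → f i ≡ g i) → Σ< n f ≡ Σ< n g
Σ<-cong zero    eq = refl
Σ<-cong (suc n) eq = cong₂ ℤ._+_ (Σ<-cong n (λ i i<n → eq i (ℕP.m<n⇒m<1+n i<n))) (eq n ℕP.≤-refl)

Σ<-zero : ∀ n {f} → (∀ i → i < n → f i ≡ + 0) → Σ< n f ≡ + 0
Σ<-zero zero    eq = refl
Σ<-zero (suc n) eq =
  cong₂ ℤ._+_ (Σ<-zero n (λ i i<n → eq i (ℕP.m<n⇒m<1+n i<n))) (eq n ℕP.≤-refl)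

Σ<-+ : ∀ n f g → Σ< n (λ i → f i ℤ.+ g i) ≡ Σ< n f ℤ.+ Σ< n g
Σ<-+ zero    f g = refl
Σ<-+ (suc n) f g = trans (cong (ℤ._+ (f n ℤ.+ g n)) (Σ<-+ n f g)) (interchange (Σ< n f) (Σ< n g) (f n) (g n))
  where
  interchange : ∀ a b c d → a ℤ.+ b ℤ.+ (c ℤ.+ d) ≡ a ℤ.+ c ℤ.+ (b ℤ.+ d)
  interchange = solve-∀

Σ<-* : ∀ n c f → Σ< n (λ i → c ℤ.* f i) ≡ c ℤ.* Σ< n f
Σ<-* zero    c f = sym (ℤP.*-zeroʳ c)
Σ<-* (suc n) c f =
  trans (cong (ℤ._+ c ℤ.* f n) (Σ<-* n c f)) (sym (ℤP.*-distribˡ-+ c (Σ< n f) (f n)))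

Σ<-neg : ∀ n f → Σ< n (λ i → - f i) ≡ - Σ< n f
Σ<-neg zero    f = refl
Σ<-neg (suc n) f =
  trans (cong (ℤ._+ - f n) (Σ<-neg n f)) (sym (ℤP.neg-distrib-+ (Σ< n f) (f n)))

Σ<-split : ∀ a b f → Σ< (a ℕ.+ b) f ≡ Σ< a f ℤ.+ Σ< b (λ i → f (a ℕ.+ i))
Σ<-split a zero    f = trans (cong (λ k → Σ< k f) (ℕP.+-identityʳ a)) (sym (ℤP.+-identityʳ _))
Σ<-split a (suc b) f = begin
  Σ< (a ℕ.+ suc b) f                                       ≡⟨ cong (λ k → Σ< k f) (ℕP.+-suc a b) ⟩
  Σ< (a ℕ.+ b) f ℤ.+ f (a ℕ.+ b)                           ≡⟨ cong (ℤ._+ f (a ℕ.+ b)) (Σ<-split a b f) ⟩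
  Σ< a f ℤ.+ Σ< b (λ i → f (a ℕ.+ i)) ℤ.+ f (a ℕ.+ b)      ≡⟨ ℤP.+-assoc (Σ< a f) _ _ ⟩
  Σ< a f ℤ.+ Σ< (suc b) (λ i → f (a ℕ.+ i))                ∎
  where open ≡-Reasoning

Σ<-trim : ∀ n N {f} → (∀ i → n ≤ i → f i ≡ + 0) → (∀ i → N ≤ i → f i ≡ + 0) → Σ< N f ≡ Σ< n f
Σ<-trim n N {f} zeroFrom-n zeroFrom-N = begin
  Σ< N f             ≡⟨ padded N n zeroFrom-N ⟨
  Σ< (N ℕ.+ n) f     ≡⟨ cong (λ k → Σ< k f) (ℕP.+-comm N n) ⟩
  Σ< (n ℕ.+ N) f     ≡⟨ padded n N zeroFrom-n ⟩
  Σ< n f             ∎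
  where
  open ≡-Reasoning
  padded : ∀ a b → (∀ i → a ≤ i → f i ≡ + 0) → Σ< (a ℕ.+ b) f ≡ Σ< a f
  padded a b zeros = trans (Σ<-split a b f)
    (trans (cong (λ s → Σ< a f ℤ.+ s) (Σ<-zero b (λ i _ → zeros (a ℕ.+ i) (ℕP.m≤m+n a i)))) (ℤP.+-identityʳ _))

Σ<-window : ∀ N a w {f} → (∀ i → i < a → f i ≡ + 0) → (∀ i → a ℕ.+ w ≤ i → f i ≡ + 0) →
            (∀ i → N ≤ i → f i ≡ + 0) → Σ< N f ≡ Σ< w (λ t → f (a ℕ.+ t))
Σ<-window N a w {f} below above beyond = begin
  Σ< N f                                      ≡⟨ Σ<-trim (a ℕ.+ w) N above beyond ⟩
  Σ< (a ℕ.+ w) f                              ≡⟨ Σ<-split a w f ⟩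
  Σ< a f ℤ.+ Σ< w (λ t → f (a ℕ.+ t))         ≡⟨ cong (ℤ._+ Σ< w (λ t → f (a ℕ.+ t))) (Σ<-zero a below) ⟩
  + 0 ℤ.+ Σ< w (λ t → f (a ℕ.+ t))            ≡⟨ ℤP.+-identityˡ (Σ< w (λ t → f (a ℕ.+ t))) ⟩
  Σ< w (λ t → f (a ℕ.+ t))                    ∎
  where open ≡-Reasoning

Σ<-single : ∀ n k {f} → k < n → (∀ i → i ≢ k → f i ≡ + 0) → Σ< n f ≡ f k
Σ<-single n k {f} k<n others = begin
  Σ< n f                ≡⟨ Σ<-window n k 1 below above beyond ⟩
  + 0 ℤ.+ f (k ℕ.+ 0)   ≡⟨ ℤP.+-identityˡ (f (k ℕ.+ 0)) ⟩
  f (k ℕ.+ 0)           ≡⟨ cong f (ℕP.+-identityʳ k) ⟩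
  f k                   ∎
  where
  open ≡-Reasoning
  below : ∀ i → i < k → f i ≡ + 0
  below i i<k = others i (ℕP.<⇒≢ i<k)
  above : ∀ i → k ℕ.+ 1 ≤ i → f i ≡ + 0
  above i k<i = others i (λ i≡k → ℕP.<-irrefl (sym i≡k) (ℕP.<-≤-trans (ℕP.m<m+n k ℕ.z<s) k<i))
  beyond : ∀ i → n ≤ i → f i ≡ + 0
  beyond i n≤i = others i (λ i≡k → ℕP.<-irrefl refl (ℕP.<-≤-trans k<n (subst (n ≤_) i≡k n≤i)))

Σ<-evenOdd : ∀ N f → Σ< (2 ℕ.* N) f ≡ Σ< N (λ K → f (2 ℕ.* K)) ℤ.+ Σ< N (λ K → f (suc (2 ℕ.* K)))
Σ<-evenOdd zero    f = refl
Σ<-evenOdd (suc N) f = begin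
  Σ< (2 ℕ.* suc N) f                                 ≡⟨ cong (λ k → Σ< k f) (ℕP.*-suc 2 N) ⟩
  Σ< (2 ℕ.* N) f ℤ.+ f (2 ℕ.* N) ℤ.+ f (suc (2 ℕ.* N))
    ≡⟨ cong (λ s → s ℤ.+ f (2 ℕ.* N) ℤ.+ f (suc (2 ℕ.* N))) (Σ<-evenOdd N f) ⟩
  evens ℤ.+ odds ℤ.+ f (2 ℕ.* N) ℤ.+ f (suc (2 ℕ.* N)) ≡⟨ interchange evens odds (f (2 ℕ.* N)) (f (suc (2 ℕ.* N))) ⟩
  (evens ℤ.+ f (2 ℕ.* N)) ℤ.+ (odds ℤ.+ f (suc (2 ℕ.* N))) ∎
  where
  open ≡-Reasoning
  evens odds : ℤ
  evens = Σ< N (λ K → f (2 ℕ.* K))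
  odds  = Σ< N (λ K → f (suc (2 ℕ.* K)))
  interchange : ∀ a b c d → a ℤ.+ b ℤ.+ c ℤ.+ d ≡ a ℤ.+ c ℤ.+ (b ℤ.+ d)
  interchange = solve-∀

Σ<-swap : ∀ n k (f : ℕ → ℕ → ℤ) → Σ< n (λ i → Σ< k (λ j → f i j)) ≡ Σ< k (λ j → Σ< n (λ i → f i j))
Σ<-swap zero    k f = sym (Σ<-zero k (λ _ _ → refl))
Σ<-swap (suc n) k f rewrite Σ<-swap n k f = sym (Σ<-+ k (λ j → Σ< n (λ i → f i j)) (λ j → f n j))

when : Bool → ℤ → ℤ
when b v = if b then v else + 0

when-cong : ∀ b {v w} → (b ≡ true → v ≡ w) → when b v ≡ when b w
when-cong true  eq = eq refl
when-cong false eq = refl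

when-zero : ∀ b → when b (+ 0) ≡ + 0
when-zero true  = refl
when-zero false = refl

when-+ : ∀ b v w → when b (v ℤ.+ w) ≡ when b v ℤ.+ when b w
when-+ true  v w = refl
when-+ false v w = refl

when-* : ∀ b c v → when b (c ℤ.* v) ≡ c ℤ.* when b v
when-* true  c v = refl
when-* false c v = sym (ℤP.*-zeroʳ c)

when-neg : ∀ b v → when b (- v) ≡ - when b v
when-neg true  v = refl
when-neg false v = refl

δ : ℕ → ℕ → ℤ → ℤ
δ x y = when (does (x ≟ y))

δ-≡ : ∀ {x y} v → x ≡ y → δ x y v ≡ v
δ-≡ {x} {y} v x≡y = cong (λ b → when b v) (dec-true (x ≟ y) x≡y)

δ-≢ : ∀ {x y} v → x ≢ y → δ x y v ≡ + 0
δ-≢ {x} {y} v x≢y = cong (λ b → when b v) (dec-false (x ≟ y) x≢y)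

δ-cong : ∀ x y {v w} → (x ≡ y → v ≡ w) → δ x y v ≡ δ x y w
δ-cong x y eq = when-cong (does (x ≟ y)) (λ holds → eq (ℕP.≡ᵇ⇒≡ x y (subst T (sym holds) tt)))

δ-iff : ∀ {x y x′ y′} v → (x ≡ y → x′ ≡ y′) → (x′ ≡ y′ → x ≡ y) → δ x y v ≡ δ x′ y′ v
δ-iff {x} {y} v to from with x ≟ y
... | yes x≡y = trans (δ-≡ v x≡y) (sym (δ-≡ v (to x≡y)))
... | no  x≢y = trans (δ-≢ v x≢y) (sym (δ-≢ v (λ x′≡y′ → x≢y (from x′≡y′))))

δ-zero : ∀ x y → δ x y (+ 0) ≡ + 0
δ-zero x y = when-zero (does (x ≟ y))

δ-sym : ∀ x y v → δ x y v ≡ δ y x v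
δ-sym x y v = δ-iff {x} {y} {y} {x} v sym sym

δ-scale : ∀ x y v → δ x y v ≡ v ℤ.* δ x y (+ 1)
δ-scale x y v = when-scale (does (x ≟ y))
  where
  when-scale : ∀ b → when b v ≡ v ℤ.* when b (+ 1)
  when-scale true  = sym (ℤP.*-identityʳ v)
  when-scale false = sym (ℤP.*-zeroʳ v)

δ-double : ∀ x y v → δ (2 ℕ.* x) (2 ℕ.* y) v ≡ δ x y v
δ-double x y v = δ-iff v (ℕP.*-cancelˡ-≡ x y 2) (cong (2 ℕ.*_))

data EvenOdd : ℕ → Set where
  even : ∀ M → EvenOdd (2 ℕ.* M)
  odd  : ∀ M → EvenOdd (suc (2 ℕ.* M))

evenOdd : ∀ m → EvenOdd m
evenOdd zero = even 0
evenOdd (suc m) with evenOdd m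
... | even M = odd M
... | odd  M = subst EvenOdd (ℕP.*-suc 2 M) (even (suc M))

parity-even : ∀ n → parity (2 ℕ.* n) ≡ 0ℙ
parity-even n = ℙP.*-homo-* 2 n

parity-odd : ∀ n → parity (suc (2 ℕ.* n)) ≡ 1ℙ
parity-odd n = trans (ℙP.+-homo-+ 1 (2 ℕ.* n)) (cong (1ℙ ℙ.+_) (parity-even n))

parity-suc : ∀ n → parity (suc n) ≡ parity n ⁻¹
parity-suc n = sym (ℙP.⁻¹-selfInverse (ℙP.suc-homo-⁻¹ n))

odd-factors : ∀ a b → parity (a ℕ.* b) ≡ 1ℙ → parity a ≡ 1ℙ × parity b ≡ 1ℙ
odd-factors a b odd-ab with parity a | ℙP.*-homo-* a b
... | 1ℙ | homo = refl , trans (sym homo) odd-ab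
... | 0ℙ | homo with trans (sym homo) odd-ab
...   | ()

onEven : Parity → ℤ → ℤ
onEven 0ℙ v = v
onEven 1ℙ v = + 0

sgn-+ : ∀ a b → sgn (a ℕ.+ b) ≡ sgn a ℤ.* sgn b
sgn-+ zero    b = sym (ℤP.*-identityˡ (sgn b))
sgn-+ (suc a) b = trans (cong -_ (sgn-+ a b)) (ℤP.neg-distribˡ-* (sgn a) (sgn b))

σ : Parity → ℤ
σ 0ℙ = -[1+ 0 ]
σ 1ℙ = + 1

sgn-suc : ∀ n → sgn (suc n) ≡ σ (parity n)
sgn-suc zero    = refl
sgn-suc (suc n) = trans (cong -_ (sgn-suc n)) (trans (flip-sign (parity n)) (cong σ (sym (parity-suc n))))
  where
  flip-sign : ∀ p → - σ p ≡ σ (p ⁻¹)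
  flip-sign 0ℙ = refl
  flip-sign 1ℙ = refl

-- divSum m G = Σ_{a b = m, a, b ≥ 1} G a b; as a, b ≤ m, the index i = a - 1 and j = b - 1 run below m
divSum : ℕ → (ℕ → ℕ → ℤ) → ℤ
divSum m G = Σ< m λ i → Σ< m λ j → δ (suc i ℕ.* suc j) m (G (suc i) (suc j))

δ-beyondˡ : ∀ {i b m} .{{_ : ℕ.NonZero b}} v → m ≤ i → δ (suc i ℕ.* b) m v ≡ + 0
δ-beyondˡ {i} {b} v m≤i = δ-≢ v (λ ab≡m → ℕP.<-irrefl (sym ab≡m) (ℕP.<-≤-trans (s≤s m≤i) (ℕP.m≤m*n (suc i) b)))

δ-beyondʳ : ∀ {a j m} .{{_ : ℕ.NonZero a}} v → m ≤ j → δ (a ℕ.* suc j) m v ≡ + 0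
δ-beyondʳ {a} {j} v m≤j = δ-≢ v (λ ab≡m → ℕP.<-irrefl (sym ab≡m) (ℕP.<-≤-trans (s≤s m≤j) (ℕP.m≤n*m (suc j) a)))

divSum-cong : ∀ m (G H : ℕ → ℕ → ℤ) → (∀ i j → suc i ℕ.* suc j ≡ m → G (suc i) (suc j) ≡ H (suc i) (suc j)) →
              divSum m G ≡ divSum m H
divSum-cong m G H eq = Σ<-cong m (λ i _ → Σ<-cong m (λ j _ → δ-cong (suc i ℕ.* suc j) m (eq i j)))

divSum-zero : ∀ m (G : ℕ → ℕ → ℤ) → (∀ i j → suc i ℕ.* suc j ≡ m → G (suc i) (suc j) ≡ + 0) → divSum m G ≡ + 0
divSum-zero m G vanish = trans (divSum-cong m G (λ _ _ → + 0) vanish)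
  (Σ<-zero m (λ i _ → Σ<-zero m (λ j _ → δ-zero (suc i ℕ.* suc j) m)))

divSum-+ : ∀ m (G H : ℕ → ℕ → ℤ) → divSum m (λ a b → G a b ℤ.+ H a b) ≡ divSum m G ℤ.+ divSum m H
divSum-+ m G H = trans (Σ<-cong m (λ i _ → trans (Σ<-cong m (λ j _ → when-+ _ (G (suc i) (suc j)) (H (suc i) (suc j))))
                                                 (Σ<-+ m _ _)))
                       (Σ<-+ m _ _)

divSum-* : ∀ m c (G : ℕ → ℕ → ℤ) → divSum m (λ a b → c ℤ.* G a b) ≡ c ℤ.* divSum m G
divSum-* m c G = trans (Σ<-cong m (λ i _ → trans (Σ<-cong m (λ j _ → when-* _ c (G (suc i) (suc j))))
                                                 (Σ<-* m c _)))
                       (Σ<-* m c _)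

divSum-neg : ∀ m (G : ℕ → ℕ → ℤ) → divSum m (λ a b → - G a b) ≡ - divSum m G
divSum-neg m G = trans (Σ<-cong m (λ i _ → trans (Σ<-cong m (λ j _ → when-neg _ (G (suc i) (suc j))))
                                                 (Σ<-neg m _)))
                       (Σ<-neg m _)

divSum-swap : ∀ m (G : ℕ → ℕ → ℤ) → divSum m G ≡ divSum m (λ a b → G b a)
divSum-swap m G = trans (Σ<-swap m m (λ i j → δ (suc i ℕ.* suc j) m (G (suc i) (suc j))))
  (Σ<-cong m (λ j _ → Σ<-cong m (λ i _ → cong (λ ab → δ ab m (G (suc i) (suc j))) (ℕP.*-comm (suc i) (suc j)))))

divSum-evenSecond : ∀ m (G : ℕ → ℕ → ℤ) →
                    divSum (2 ℕ.* m) (λ a b → onEven (parity b) (G a b)) ≡ divSum m (λ a b → G a (2 ℕ.* b))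
divSum-evenSecond m G = trans (Σ<-cong (2 ℕ.* m) (λ i _ → row i)) (Σ<-trim m (2 ℕ.* m) rowBeyond rowBeyond′)
  where
  halved : ℕ → ℤ
  halved i = Σ< m (λ K → δ (suc i ℕ.* suc K) m (G (suc i) (2 ℕ.* suc K)))
  rowBeyond : ∀ i → m ≤ i → halved i ≡ + 0
  rowBeyond i m≤i = Σ<-zero m (λ K _ → δ-beyondˡ (G (suc i) (2 ℕ.* suc K)) m≤i)
  rowBeyond′ : ∀ i → 2 ℕ.* m ≤ i → halved i ≡ + 0
  rowBeyond′ i 2m≤i = rowBeyond i (ℕP.≤-trans (ℕP.m≤n*m m 2) 2m≤i)
  row : ∀ i → Σ< (2 ℕ.* m) (λ j → δ (suc i ℕ.* suc j) (2 ℕ.* m) (onEven (parity (suc j)) (G (suc i) (suc j)))) ≡ halved i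
  row i = begin
    Σ< (2 ℕ.* m) φ                                                    ≡⟨ Σ<-evenOdd m φ ⟩
    Σ< m (λ K → φ (2 ℕ.* K)) ℤ.+ Σ< m (λ K → φ (suc (2 ℕ.* K)))
      ≡⟨ cong₂ ℤ._+_ (Σ<-zero m (λ K _ → oddSecond K)) (Σ<-cong m (λ K _ → evenSecond K)) ⟩
    + 0 ℤ.+ halved i                                                  ≡⟨ ℤP.+-identityˡ (halved i) ⟩
    halved i                                                          ∎
    where
    open ≡-Reasoning
    reassoc : ∀ a b → a ℕ.* (2 ℕ.* b) ≡ 2 ℕ.* (a ℕ.* b)
    reassoc = ℕSolver.solve-∀
    φ : ℕ → ℤ
    φ j = δ (suc i ℕ.* suc j) (2 ℕ.* m) (onEven (parity (suc j)) (G (suc i) (suc j)))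
    oddSecond : ∀ K → φ (2 ℕ.* K) ≡ + 0
    oddSecond K = trans (cong (λ p → δ (suc i ℕ.* suc (2 ℕ.* K)) (2 ℕ.* m) (onEven p (G (suc i) (suc (2 ℕ.* K)))))
                              (parity-odd K))
                        (δ-zero (suc i ℕ.* suc (2 ℕ.* K)) (2 ℕ.* m))
    evenSecond : ∀ K → φ (suc (2 ℕ.* K)) ≡ δ (suc i ℕ.* suc K) m (G (suc i) (2 ℕ.* suc K))
    evenSecond K = begin
      φ (suc (2 ℕ.* K))
        ≡⟨ cong (λ b → δ (suc i ℕ.* b) (2 ℕ.* m) (onEven (parity b) (G (suc i) b))) (sym (ℕP.*-suc 2 K)) ⟩
      δ (suc i ℕ.* (2 ℕ.* suc K)) (2 ℕ.* m) (onEven (parity (2 ℕ.* suc K)) (G (suc i) (2 ℕ.* suc K)))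
        ≡⟨ cong (λ p → δ (suc i ℕ.* (2 ℕ.* suc K)) (2 ℕ.* m) (onEven p (G (suc i) (2 ℕ.* suc K)))) (parity-even (suc K)) ⟩
      δ (suc i ℕ.* (2 ℕ.* suc K)) (2 ℕ.* m) (G (suc i) (2 ℕ.* suc K))
        ≡⟨ cong (λ x → δ x (2 ℕ.* m) (G (suc i) (2 ℕ.* suc K))) (reassoc (suc i) (suc K)) ⟩
      δ (2 ℕ.* (suc i ℕ.* suc K)) (2 ℕ.* m) (G (suc i) (2 ℕ.* suc K))
        ≡⟨ δ-double (suc i ℕ.* suc K) m (G (suc i) (2 ℕ.* suc K)) ⟩
      δ (suc i ℕ.* suc K) m (G (suc i) (2 ℕ.* suc K)) ∎

-- a factorisation of an odd number has an odd second factor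
divSum-oddEvenSecond : ∀ M (G : ℕ → ℕ → ℤ) → divSum (suc (2 ℕ.* M)) (λ a b → onEven (parity b) (G a b)) ≡ + 0
divSum-oddEvenSecond M G = divSum-zero (suc (2 ℕ.* M)) (λ a b → onEven (parity b) (G a b)) vanish
  where
  vanish : ∀ i j → suc i ℕ.* suc j ≡ suc (2 ℕ.* M) → onEven (parity (suc j)) (G (suc i) (suc j)) ≡ + 0
  vanish i j ab≡m = cong (λ p → onEven p (G (suc i) (suc j)))
                         (proj₂ (odd-factors (suc i) (suc j) (trans (cong parity ab≡m) (parity-odd M))))

-- for even m both sides equal Σ_{x y = m/2} P (2 x) (2 y), and for odd m both vanish
divSum-transfer : ∀ m (P : ℕ → ℕ → ℤ) →
                  divSum m (λ a b → onEven (parity b) (P (2 ℕ.* a) b)) ≡ divSum m (λ a b → onEven (parity a) (P a (2 ℕ.* b)))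
divSum-transfer m P with evenOdd m
... | even M = begin
  divSum (2 ℕ.* M) (λ a b → onEven (parity b) (P (2 ℕ.* a) b))      ≡⟨ divSum-evenSecond M (λ a b → P (2 ℕ.* a) b) ⟩
  divSum M (λ a b → P (2 ℕ.* a) (2 ℕ.* b))                          ≡⟨ divSum-swap M (λ a b → P (2 ℕ.* a) (2 ℕ.* b)) ⟩
  divSum M (λ a b → P (2 ℕ.* b) (2 ℕ.* a))                          ≡⟨ divSum-evenSecond M (λ a b → P b (2 ℕ.* a)) ⟨
  divSum (2 ℕ.* M) (λ a b → onEven (parity b) (P b (2 ℕ.* a)))
    ≡⟨ divSum-swap (2 ℕ.* M) (λ a b → onEven (parity b) (P b (2 ℕ.* a))) ⟩
  divSum (2 ℕ.* M) (λ a b → onEven (parity a) (P a (2 ℕ.* b)))      ∎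
  where open ≡-Reasoning
... | odd M = begin
  divSum (suc (2 ℕ.* M)) (λ a b → onEven (parity b) (P (2 ℕ.* a) b)) ≡⟨ divSum-oddEvenSecond M (λ a b → P (2 ℕ.* a) b) ⟩
  + 0                                                                  ≡⟨ divSum-oddEvenSecond M (λ a b → P b (2 ℕ.* a)) ⟨
  divSum (suc (2 ℕ.* M)) (λ a b → onEven (parity b) (P b (2 ℕ.* a)))
    ≡⟨ divSum-swap (suc (2 ℕ.* M)) (λ a b → onEven (parity b) (P b (2 ℕ.* a))) ⟩
  divSum (suc (2 ℕ.* M)) (λ a b → onEven (parity a) (P a (2 ℕ.* b))) ∎
  where open ≡-Reasoning

data Cmp : Set where
  lt eq gt : Cmp

cmp : ℕ → ℕ → Cmp
cmp zero    zero    = eq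
cmp zero    (suc _) = lt
cmp (suc _) zero    = gt
cmp (suc x) (suc y) = cmp x y

opposite : Cmp → Cmp
opposite lt = gt
opposite eq = eq
opposite gt = lt

cmp-flip : ∀ x y → cmp y x ≡ opposite (cmp x y)
cmp-flip zero    zero    = refl
cmp-flip zero    (suc y) = refl
cmp-flip (suc x) zero    = refl
cmp-flip (suc x) (suc y) = cmp-flip x y

cmp-lt : ∀ {x y} → x < y → cmp x y ≡ lt
cmp-lt {zero}  {suc y} _         = refl
cmp-lt {suc x} {suc y} (s≤s x<y) = cmp-lt x<y

cmp-gt : ∀ {x y} → y < x → cmp x y ≡ gt
cmp-gt {x} {y} y<x = trans (cmp-flip y x) (cong opposite (cmp-lt y<x))

cmp-eq : ∀ {x y} → x ≡ y → cmp x y ≡ eq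
cmp-eq {zero}  refl = refl
cmp-eq {suc x} refl = cmp-eq {x} refl

signum : Cmp → ℤ
signum lt = -[1+ 0 ]
signum eq = + 0
signum gt = + 1

Fw : Cmp → Parity → Parity → ℤ
Fw lt 1ℙ 0ℙ = + 1
Fw lt 0ℙ 1ℙ = -[1+ 0 ]
Fw lt 0ℙ 0ℙ = + 0
Fw lt 1ℙ 1ℙ = + 0
Fw eq _  _  = + 0
Fw gt _  _  = + 0

-- 2 M = n d contributes F n d to the coefficient of q^M in h
F : ℕ → ℕ → ℤ
F n d = Fw (cmp n d) (parity n) (parity d)

rw : Cmp → Cmp → Parity → ℤ
rw lt lt p = + 2 ℤ.* σ p
rw lt eq p = σ p
rw eq lt p = σ p
rw _  _  _ = + 0

-- m = n e contributes r n e to the coefficient of q^m in the right-hand side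
r : ℕ → ℕ → ℤ
r n e = rw (cmp n e) (cmp e (2 ℕ.* n)) (parity e)

-- m = a b contributes Λ a b to the coefficient of q^m in h(q) - 2 h(q²)
Λ : ℕ → ℕ → ℤ
Λ a b = F a (2 ℕ.* b) ℤ.+ F (2 ℕ.* a) b ℤ.- (+ 2) ℤ.* F a b

X^-* : ∀ k i x → X^ k i ℤ.* x ≡ δ i k x
X^-* k i x = unit-* (does (i ≟ k))
  where
  unit-* : ∀ b → when b (+ 1) ℤ.* x ≡ when b x
  unit-* true  = ℤP.*-identityˡ x
  unit-* false = refl

X^-⊛-coeff : ∀ T g M → (X^ T ⊛ g) M ≡ Σ< (suc M) (λ i → δ i T (g (M ∸ i)))
X^-⊛-coeff T g M = trans (Σℤ≤≡Σ< M (λ i → X^ T i ℤ.* g (M ∸ i))) (Σ<-cong (suc M) (λ i _ → X^-* T i (g (M ∸ i))))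

X^-⊛ : ∀ T g M N (u : ℕ → ℕ) (v : ℕ → ℤ) → (∀ j → j ≤ M → g j ≡ Σ< N (λ t → δ j (u t) (v t))) →
       (X^ T ⊛ g) M ≡ Σ< N (λ t → δ M (T ℕ.+ u t) (v t))
X^-⊛ T g M N u v g≈ with T ℕ.≤? M
... | yes T≤M = begin
  (X^ T ⊛ g) M                              ≡⟨ X^-⊛-coeff T g M ⟩
  Σ< (suc M) (λ i → δ i T (g (M ∸ i)))     ≡⟨ Σ<-single (suc M) T (s≤s T≤M) (λ i i≢T → δ-≢ (g (M ∸ i)) i≢T) ⟩
  δ T T (g (M ∸ T))                         ≡⟨ δ-≡ {T} (g (M ∸ T)) refl ⟩
  g (M ∸ T)                                 ≡⟨ g≈ (M ∸ T) (ℕP.m∸n≤m M T) ⟩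
  Σ< N (λ t → δ (M ∸ T) (u t) (v t))        ≡⟨ Σ<-cong N (λ t _ → δ-iff (v t) (shift t) (unshift t)) ⟩
  Σ< N (λ t → δ M (T ℕ.+ u t) (v t))        ∎
  where
  open ≡-Reasoning
  shift : ∀ t → M ∸ T ≡ u t → M ≡ T ℕ.+ u t
  shift t e = trans (sym (ℕP.m+[n∸m]≡n T≤M)) (cong (T ℕ.+_) e)
  unshift : ∀ t → M ≡ T ℕ.+ u t → M ∸ T ≡ u t
  unshift t e = trans (cong (_∸ T) e) (ℕP.m+n∸m≡n T (u t))
... | no T≰M = begin
  (X^ T ⊛ g) M                              ≡⟨ X^-⊛-coeff T g M ⟩
  Σ< (suc M) (λ i → δ i T (g (M ∸ i)))
    ≡⟨ Σ<-zero (suc M) (λ i i≤M → δ-≢ (g (M ∸ i)) (λ i≡T → T≰M (subst (_≤ M) i≡T (ℕP.≤-pred i≤M)))) ⟩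
  + 0
    ≡⟨ Σ<-zero N (λ t _ → δ-≢ (v t) (λ M≡T+u → T≰M (subst (T ≤_) (sym M≡T+u) (ℕP.m≤m+n T (u t))))) ⟨
  Σ< N (λ t → δ M (T ℕ.+ u t) (v t))        ∎
  where open ≡-Reasoning

geom-coeff : ∀ n M j .{{_ : ℕ.NonZero n}} → j ≤ M → geom n j ≡ Σ< (suc M) (λ K → δ j (n ℕ.* K) (+ 1))
geom-coeff n M j j≤M = trans (Σℤ≤≡Σ< j (λ K → δ j (n ℕ.* K) (+ 1)))
                              (Σ<-trim (suc M) (suc j) (λ K M<K → beyond K (ℕP.≤-trans (s≤s j≤M) M<K)) beyond)
  where
  beyond : ∀ K → j < K → δ j (n ℕ.* K) (+ 1) ≡ + 0
  beyond K j<K = δ-≢ (+ 1) (λ j≡nK → ℕP.<-irrefl j≡nK (ℕP.<-≤-trans j<K (ℕP.m≤n*m K n)))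

hits : ℕ → ℕ → ℤ
hits n M = Σ< (suc M) (λ K → δ M (tri n ℕ.+ n ℕ.* K) (+ 1))

hSummand-coeff : ∀ n M .{{_ : ℕ.NonZero n}} → (X^ (tri n) ⊛ geom n) M ≡ hits n M
hSummand-coeff n M = X^-⊛ (tri n) (geom n) M (suc M) (n ℕ.*_) (λ _ → + 1) (λ j j≤M → geom-coeff n M j j≤M)

tri-bound : ∀ n → n ≤ tri n
tri-bound zero    = z≤n
tri-bound (suc n) = ℕP.m≤m+n (suc n) (tri n)

hits-vanish : ∀ n M → M < tri n → hits n M ≡ + 0
hits-vanish n M M<T =
  Σ<-zero (suc M) (λ K _ → δ-≢ (+ 1) (λ M≡T+nK → ℕP.<-irrefl M≡T+nK (ℕP.<-≤-trans M<T (ℕP.m≤m+n (tri n) (n ℕ.* K)))))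

hSummand : ℕ → ℕ → ℤ
hSummand M k = σ (parity (suc k)) ℤ.* hits (suc k) M

hSummand-vanish : ∀ M k → M ≤ k → hSummand M k ≡ + 0
hSummand-vanish M k M≤k =
  trans (cong (σ (parity (suc k)) ℤ.*_) (hits-vanish (suc k) M (ℕP.<-≤-trans (s≤s M≤k) (tri-bound (suc k)))))
        (ℤP.*-zeroʳ (σ (parity (suc k))))

h-coeff-sum : ∀ M → h M ≡ Σ< M (hSummand M)
h-coeff-sum M = begin
  h M                        ≡⟨ Σℤ≤≡Σ< M (λ k → (sgn (suc (suc k)) · (X^ (tri (suc k)) ⊛ geom (suc k))) M) ⟩
  Σ< (suc M) (λ k → sgn (suc (suc k)) ℤ.* (X^ (tri (suc k)) ⊛ geom (suc k)) M)
                             ≡⟨ Σ<-cong (suc M) (λ k _ → cong₂ ℤ._*_ (sgn-suc (suc k)) (hSummand-coeff (suc k) M)) ⟩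
  Σ< (suc M) (hSummand M)    ≡⟨ Σ<-trim M (suc M) (hSummand-vanish M) (λ k M<k → hSummand-vanish M k (ℕP.<⇒≤ M<k)) ⟩
  Σ< M (hSummand M)          ∎
  where open ≡-Reasoning

tri-double : ∀ n → 2 ℕ.* tri n ≡ n ℕ.* suc n
tri-double zero    = refl
tri-double (suc n) = begin
  2 ℕ.* (suc n ℕ.+ tri n)              ≡⟨ ℕP.*-distribˡ-+ 2 (suc n) (tri n) ⟩
  2 ℕ.* suc n ℕ.+ 2 ℕ.* tri n          ≡⟨ cong (2 ℕ.* suc n ℕ.+_) (tri-double n) ⟩
  2 ℕ.* suc n ℕ.+ n ℕ.* suc n          ≡⟨ collect n ⟩
  suc n ℕ.* suc (suc n)                ∎
  where
  open ≡-Reasoning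
  collect : ∀ n → 2 ℕ.* suc n ℕ.+ n ℕ.* suc n ≡ suc n ℕ.* suc (suc n)
  collect = ℕSolver.solve-∀

factor-tri : ∀ n K → n ℕ.* suc (n ℕ.+ 2 ℕ.* K) ≡ 2 ℕ.* (tri n ℕ.+ n ℕ.* K)
factor-tri n K = begin
  n ℕ.* suc (n ℕ.+ 2 ℕ.* K)            ≡⟨ expand n K ⟩
  n ℕ.* suc n ℕ.+ 2 ℕ.* (n ℕ.* K)      ≡⟨ cong (ℕ._+ 2 ℕ.* (n ℕ.* K)) (tri-double n) ⟨
  2 ℕ.* tri n ℕ.+ 2 ℕ.* (n ℕ.* K)      ≡⟨ ℕP.*-distribˡ-+ 2 (tri n) (n ℕ.* K) ⟨
  2 ℕ.* (tri n ℕ.+ n ℕ.* K)            ∎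
  where
  open ≡-Reasoning
  expand : ∀ n K → n ℕ.* suc (n ℕ.+ 2 ℕ.* K) ≡ n ℕ.* suc n ℕ.+ 2 ℕ.* (n ℕ.* K)
  expand = ℕSolver.solve-∀

F-below : ∀ {n d} → d ≤ n → F n d ≡ + 0
F-below {n} {d} d≤n with ℕP.m≤n⇒m<n∨m≡n d≤n
... | inj₁ d<n  rewrite cmp-gt d<n          = refl
... | inj₂ refl rewrite cmp-eq {n} {n} refl = refl

F-above : ∀ n t → F n (suc (n ℕ.+ t)) ≡ onEven (parity t) (σ (parity n))
F-above n t rewrite cmp-lt {n} {suc (n ℕ.+ t)} (s≤s (ℕP.m≤m+n n t)) | parity-suc (n ℕ.+ t) | ℙP.+-homo-+ n t
  = table (parity n) (parity t)
  where
  table : ∀ p q → Fw lt p ((p ℙ.+ q) ⁻¹) ≡ onEven q (σ p)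
  table 0ℙ 0ℙ = refl
  table 0ℙ 1ℙ = refl
  table 1ℙ 0ℙ = refl
  table 1ℙ 1ℙ = refl

F-evenOffset : ∀ n M K → δ (n ℕ.* suc (n ℕ.+ 2 ℕ.* K)) (2 ℕ.* M) (F n (suc (n ℕ.+ 2 ℕ.* K)))
                         ≡ σ (parity n) ℤ.* δ M (tri n ℕ.+ n ℕ.* K) (+ 1)
F-evenOffset n M K = begin
  δ (n ℕ.* suc (n ℕ.+ 2 ℕ.* K)) (2 ℕ.* M) (F n (suc (n ℕ.+ 2 ℕ.* K)))
    ≡⟨ cong (δ (n ℕ.* suc (n ℕ.+ 2 ℕ.* K)) (2 ℕ.* M))
            (trans (F-above n (2 ℕ.* K)) (cong (λ p → onEven p σn) (parity-even K))) ⟩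
  δ (n ℕ.* suc (n ℕ.+ 2 ℕ.* K)) (2 ℕ.* M) σn
    ≡⟨ cong (λ x → δ x (2 ℕ.* M) σn) (factor-tri n K) ⟩
  δ (2 ℕ.* (tri n ℕ.+ n ℕ.* K)) (2 ℕ.* M) σn
    ≡⟨ δ-double (tri n ℕ.+ n ℕ.* K) M σn ⟩
  δ (tri n ℕ.+ n ℕ.* K) M σn
    ≡⟨ δ-sym (tri n ℕ.+ n ℕ.* K) M σn ⟩
  δ M (tri n ℕ.+ n ℕ.* K) σn
    ≡⟨ δ-scale M (tri n ℕ.+ n ℕ.* K) σn ⟩
  σn ℤ.* δ M (tri n ℕ.+ n ℕ.* K) (+ 1) ∎
  where
  open ≡-Reasoning
  σn : ℤ
  σn = σ (parity n)

-- the divisor d = n + 2 + 2 K has the parity of n and contributes nothing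
F-oddOffset : ∀ n M K → δ (n ℕ.* suc (n ℕ.+ suc (2 ℕ.* K))) (2 ℕ.* M) (F n (suc (n ℕ.+ suc (2 ℕ.* K)))) ≡ + 0
F-oddOffset n M K = trans (cong (δ (n ℕ.* suc (n ℕ.+ suc (2 ℕ.* K))) (2 ℕ.* M))
                                (trans (F-above n (suc (2 ℕ.* K))) (cong (λ p → onEven p (σ (parity n))) (parity-odd K))))
                          (δ-zero (n ℕ.* suc (n ℕ.+ suc (2 ℕ.* K))) (2 ℕ.* M))

-- for fixed n, the divisors d of 2 M with F n d ≠ 0 are d = n + 1 + 2 K with M = n(n+1)/2 + n K:
-- the terms d ≤ n vanish, and the remaining ones are split by the parity of d - n - 1
F-row : ∀ n M .{{_ : ℕ.NonZero n}} →
        Σ< (2 ℕ.* M) (λ j → δ (n ℕ.* suc j) (2 ℕ.* M) (F n (suc j))) ≡ σ (parity n) ℤ.* hits n M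
F-row n M = begin
  Σ< (2 ℕ.* M) χ
    ≡⟨ Σ<-window (2 ℕ.* M) n (2 ℕ.* suc M) below above beyond ⟩
  Σ< (2 ℕ.* suc M) (λ t → χ (n ℕ.+ t))
    ≡⟨ Σ<-evenOdd (suc M) (λ t → χ (n ℕ.+ t)) ⟩
  Σ< (suc M) (λ K → χ (n ℕ.+ 2 ℕ.* K)) ℤ.+ Σ< (suc M) (λ K → χ (n ℕ.+ suc (2 ℕ.* K)))
    ≡⟨ cong₂ ℤ._+_ (Σ<-cong (suc M) (λ K _ → F-evenOffset n M K)) (Σ<-zero (suc M) (λ K _ → F-oddOffset n M K)) ⟩
  Σ< (suc M) (λ K → σ (parity n) ℤ.* δ M (tri n ℕ.+ n ℕ.* K) (+ 1)) ℤ.+ + 0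
    ≡⟨ ℤP.+-identityʳ _ ⟩
  Σ< (suc M) (λ K → σ (parity n) ℤ.* δ M (tri n ℕ.+ n ℕ.* K) (+ 1))
    ≡⟨ Σ<-* (suc M) (σ (parity n)) (λ K → δ M (tri n ℕ.+ n ℕ.* K) (+ 1)) ⟩
  σ (parity n) ℤ.* hits n M ∎
  where
  open ≡-Reasoning
  χ : ℕ → ℤ
  χ j = δ (n ℕ.* suc j) (2 ℕ.* M) (F n (suc j))
  beyond : ∀ j → 2 ℕ.* M ≤ j → χ j ≡ + 0
  beyond j 2M≤j = δ-beyondʳ (F n (suc j)) 2M≤j
  above : ∀ j → n ℕ.+ 2 ℕ.* suc M ≤ j → χ j ≡ + 0
  above j le = beyond j (ℕP.≤-trans (ℕP.≤-trans (ℕP.*-monoʳ-≤ 2 (ℕP.n≤1+n M)) (ℕP.m≤n+m (2 ℕ.* suc M) n)) le)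
  below : ∀ j → j < n → χ j ≡ + 0
  below j j<n = trans (cong (δ (n ℕ.* suc j) (2 ℕ.* M)) (F-below j<n)) (δ-zero (n ℕ.* suc j) (2 ℕ.* M))

h-coeff : ∀ M → h M ≡ divSum (2 ℕ.* M) F
h-coeff M = begin
  h M                                   ≡⟨ h-coeff-sum M ⟩
  Σ< M (hSummand M)
    ≡⟨ Σ<-trim M (2 ℕ.* M) (hSummand-vanish M) (λ k 2M≤k → hSummand-vanish M k (ℕP.≤-trans (ℕP.m≤n*m M 2) 2M≤k)) ⟨
  Σ< (2 ℕ.* M) (hSummand M)             ≡⟨ Σ<-cong (2 ℕ.* M) (λ k _ → sym (F-row (suc k) M)) ⟩
  divSum (2 ℕ.* M) F                    ∎
  where open ≡-Reasoning

-- F n d ≠ 0 forces n, d to have opposite parities, so exactly one of them is even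
F-split : ∀ a b → F a b ≡ onEven (parity b) (F a b) ℤ.+ onEven (parity a) (F a b)
F-split a b = split (cmp a b) (parity a) (parity b)
  where
  split : ∀ c p q → Fw c p q ≡ onEven q (Fw c p q) ℤ.+ onEven p (Fw c p q)
  split lt 0ℙ 0ℙ = refl
  split lt 0ℙ 1ℙ = refl
  split lt 1ℙ 0ℙ = refl
  split lt 1ℙ 1ℙ = refl
  split eq 0ℙ 0ℙ = refl
  split eq 0ℙ 1ℙ = refl
  split eq 1ℙ 0ℙ = refl
  split eq 1ℙ 1ℙ = refl
  split gt 0ℙ 0ℙ = refl
  split gt 0ℙ 1ℙ = refl
  split gt 1ℙ 0ℙ = refl
  split gt 1ℙ 1ℙ = refl

h-coeff-split : ∀ m → divSum (2 ℕ.* m) F ≡ divSum m (λ a b → F a (2 ℕ.* b)) ℤ.+ divSum m (λ a b → F (2 ℕ.* a) b)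
h-coeff-split m = begin
  divSum (2 ℕ.* m) F
    ≡⟨ divSum-cong (2 ℕ.* m) F (λ a b → onEven (parity b) (F a b) ℤ.+ onEven (parity a) (F a b))
                   (λ i j _ → F-split (suc i) (suc j)) ⟩
  divSum (2 ℕ.* m) (λ a b → onEven (parity b) (F a b) ℤ.+ onEven (parity a) (F a b))
    ≡⟨ divSum-+ (2 ℕ.* m) (λ a b → onEven (parity b) (F a b)) (λ a b → onEven (parity a) (F a b)) ⟩
  divSum (2 ℕ.* m) (λ a b → onEven (parity b) (F a b)) ℤ.+ divSum (2 ℕ.* m) (λ a b → onEven (parity a) (F a b))
    ≡⟨ cong₂ ℤ._+_ (divSum-evenSecond m F) evenFirst ⟩
  divSum m (λ a b → F a (2 ℕ.* b)) ℤ.+ divSum m (λ a b → F (2 ℕ.* a) b) ∎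
  where
  open ≡-Reasoning
  evenFirst : divSum (2 ℕ.* m) (λ a b → onEven (parity a) (F a b)) ≡ divSum m (λ a b → F (2 ℕ.* a) b)
  evenFirst = begin
    divSum (2 ℕ.* m) (λ a b → onEven (parity a) (F a b)) ≡⟨ divSum-swap (2 ℕ.* m) (λ a b → onEven (parity a) (F a b)) ⟩
    divSum (2 ℕ.* m) (λ a b → onEven (parity b) (F b a)) ≡⟨ divSum-evenSecond m (λ a b → F b a) ⟩
    divSum m (λ a b → F (2 ℕ.* b) a)                     ≡⟨ divSum-swap m (λ a b → F (2 ℕ.* a) b) ⟨
    divSum m (λ a b → F (2 ℕ.* a) b)                     ∎

-- h(q²) has coefficient h_{m/2} at even m and 0 at odd m, where F vanishes on odd · odd
sub2h-coeff : ∀ m → sub2 h m ≡ divSum m F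
sub2h-coeff m with evenOdd m
... | even M = begin
  sub2 h (2 ℕ.* M)        ≡⟨ cong (λ b → if b then h (2 ℕ.* M ℕ./ 2) else + 0) (dec-true (2 ∣? 2 ℕ.* M) (m∣m*n M)) ⟩
  h (2 ℕ.* M ℕ./ 2)       ≡⟨ cong h (trans (cong (ℕ._/ 2) (ℕP.*-comm 2 M)) (m*n/n≡m M 2)) ⟩
  h M                     ≡⟨ h-coeff M ⟩
  divSum (2 ℕ.* M) F      ∎
  where open ≡-Reasoning
... | odd M = begin
  sub2 h (suc (2 ℕ.* M))
    ≡⟨ cong (λ b → if b then h (suc (2 ℕ.* M) ℕ./ 2) else + 0) (dec-false (2 ∣? suc (2 ℕ.* M)) not-even) ⟩
  + 0
    ≡⟨ divSum-zero (suc (2 ℕ.* M)) F (λ i j ab≡m → oddOdd i j (odd-factors (suc i) (suc j) (oddProduct ab≡m))) ⟨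
  divSum (suc (2 ℕ.* M)) F ∎
  where
  open ≡-Reasoning
  oddProduct : ∀ {a} → a ≡ suc (2 ℕ.* M) → parity a ≡ 1ℙ
  oddProduct a≡m = trans (cong parity a≡m) (parity-odd M)
  not-even : ¬ (2 ∣ suc (2 ℕ.* M))
  not-even (divides q m≡2q) = ℕP.even≢odd q M (sym (trans m≡2q (ℕP.*-comm q 2)))
  oddOdd : ∀ i j → parity (suc i) ≡ 1ℙ × parity (suc j) ≡ 1ℙ → F (suc i) (suc j) ≡ + 0
  oddOdd i j (pa , pb) rewrite pa | pb with cmp (suc i) (suc j)
  ... | lt = refl
  ... | eq = refl
  ... | gt = refl

lhs-coeff : ∀ m → (h ⊖ (+ 2) · sub2 h) m ≡ divSum m Λ
lhs-coeff m = begin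
  h m ℤ.- (+ 2) ℤ.* sub2 h m
    ≡⟨ cong₂ (λ x y → x ℤ.- (+ 2) ℤ.* y) (trans (h-coeff m) (h-coeff-split m)) (sub2h-coeff m) ⟩
  divSum m X ℤ.+ divSum m Y ℤ.- (+ 2) ℤ.* divSum m F
    ≡⟨ cong₂ ℤ._+_ (divSum-+ m X Y) (trans (divSum-neg m (λ a b → (+ 2) ℤ.* F a b)) (cong -_ (divSum-* m (+ 2) F))) ⟨
  divSum m (λ a b → X a b ℤ.+ Y a b) ℤ.+ divSum m (λ a b → - ((+ 2) ℤ.* F a b))
    ≡⟨ divSum-+ m (λ a b → X a b ℤ.+ Y a b) (λ a b → - ((+ 2) ℤ.* F a b)) ⟨
  divSum m Λ ∎
  where
  open ≡-Reasoning
  X Y : ℕ → ℕ → ℤ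
  X a b = F a (2 ℕ.* b)
  Y a b = F (2 ℕ.* a) b

bracket : ℕ → FPS
bracket n = const (+ 1) ⊕ (+ 2) · ΣFin 1 (n ∸ 1) (λ i → sgn i · X^ (i ℕ.* n)) ⊕ sgn n · X^ (n ℕ.* n)

bracketCoeff : ℕ → ℕ → ℤ
bracketCoeff n zero    = + 1
bracketCoeff n (suc t) = if does (suc t ≟ n) then sgn n else + 2 ℤ.* sgn (suc t)

bracketCoeff-last : ∀ k → bracketCoeff (suc k) (suc k) ≡ sgn (suc k)
bracketCoeff-last k = cong (if_then sgn (suc k) else + 2 ℤ.* sgn (suc k)) (dec-true (suc k ≟ suc k) refl)

bracketCoeff-interior : ∀ n t → suc t ≢ n → bracketCoeff n (suc t) ≡ + 2 ℤ.* sgn (suc t)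
bracketCoeff-interior n t t+1≢n = cong (if_then sgn n else + 2 ℤ.* sgn (suc t)) (dec-false (suc t ≟ n) t+1≢n)

ΣFin-from1 : ∀ k (G : ℕ → FPS) j → ΣFin 1 k G j ≡ Σ< k (λ t → G (suc t) j)
ΣFin-from1 zero    G j = refl
ΣFin-from1 (suc k) G j = cong (ℤ._+ G (suc k) j) (ΣFin-from1 k G j)

bracket-coeff : ∀ k j → bracket (suc k) j ≡ Σ< (suc (suc k)) (λ t → δ j (t ℕ.* suc k) (bracketCoeff (suc k) t))
bracket-coeff k j = begin
  const (+ 1) j ℤ.+ (+ 2) ℤ.* ΣFin 1 k (λ i → sgn i · X^ (i ℕ.* n)) j ℤ.+ sgn n ℤ.* X^ (n ℕ.* n) j
      ≡⟨ cong₂ ℤ._+_ (cong₂ ℤ._+_ (constant-coeff j) middle) (sym (δ-scale j (n ℕ.* n) (sgn n))) ⟩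
  φ 0 ℤ.+ Σ< k (λ t → φ (suc t)) ℤ.+ δ j (n ℕ.* n) (sgn n)
      ≡⟨ cong (λ c → φ 0 ℤ.+ Σ< k (λ t → φ (suc t)) ℤ.+ δ j (n ℕ.* n) c) (bracketCoeff-last k) ⟨
  φ 0 ℤ.+ Σ< k (λ t → φ (suc t)) ℤ.+ φ n
      ≡⟨ cong (λ s → s ℤ.+ φ n) (trans (cong (ℤ._+ Σ< k (λ t → φ (suc t))) (sym (ℤP.+-identityˡ (φ 0))))
                                       (sym (Σ<-split 1 k φ))) ⟩
  Σ< (suc (suc k)) φ ∎
  where
  open ≡-Reasoning
  n : ℕ
  n = suc k
  φ : ℕ → ℤ
  φ t = δ j (t ℕ.* n) (bracketCoeff n t)
  constant-coeff : ∀ i → const (+ 1) i ≡ δ i 0 (+ 1)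
  constant-coeff zero    = refl
  constant-coeff (suc _) = refl
  interior : ∀ t → t < k → (+ 2) ℤ.* (sgn (suc t) ℤ.* X^ (suc t ℕ.* n) j) ≡ φ (suc t)
  interior t t<k = begin
    (+ 2) ℤ.* (sgn (suc t) ℤ.* δ j (suc t ℕ.* n) (+ 1))   ≡⟨ ℤP.*-assoc (+ 2) (sgn (suc t)) _ ⟨
    (+ 2) ℤ.* sgn (suc t) ℤ.* δ j (suc t ℕ.* n) (+ 1)     ≡⟨ δ-scale j (suc t ℕ.* n) ((+ 2) ℤ.* sgn (suc t)) ⟨
    δ j (suc t ℕ.* n) ((+ 2) ℤ.* sgn (suc t))
      ≡⟨ cong (δ j (suc t ℕ.* n)) (bracketCoeff-interior n t (λ t+1≡n → ℕP.<-irrefl (ℕP.suc-injective t+1≡n) t<k)) ⟨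
    φ (suc t)                                              ∎
  middle : (+ 2) ℤ.* ΣFin 1 k (λ i → sgn i · X^ (i ℕ.* n)) j ≡ Σ< k (λ t → φ (suc t))
  middle = trans (cong ((+ 2) ℤ.*_) (ΣFin-from1 k (λ i → sgn i · X^ (i ℕ.* n)) j))
                 (trans (sym (Σ<-* k (+ 2) (λ t → sgn (suc t) ℤ.* X^ (suc t ℕ.* n) j))) (Σ<-cong k interior))

sign-shift : ∀ n t → sgn (suc n) ℤ.* sgn t ≡ σ (parity (n ℕ.+ t))
sign-shift n t = trans (sym (sgn-+ (suc n) t)) (sgn-suc (n ℕ.+ t))

r-value : ∀ n e {c₁ c₂} → cmp n e ≡ c₁ → cmp e (2 ℕ.* n) ≡ c₂ → r n e ≡ rw c₁ c₂ (parity e)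
r-value n e ne≡c₁ e2n≡c₂ rewrite ne≡c₁ | e2n≡c₂ = refl

n<2n : ∀ n .{{_ : ℕ.NonZero n}} → n < 2 ℕ.* n
n<2n n = ℕP.m<m+n n (ℕP.<-≤-trans (ℕ.>-nonZero⁻¹ n) (ℕP.m≤m+n n 0))

twice : ∀ n → n ℕ.+ n ≡ 2 ℕ.* n
twice n = cong (n ℕ.+_) (sym (ℕP.+-identityʳ n))

r-below : ∀ {n e} → e < n → r n e ≡ + 0
r-below e<n rewrite cmp-gt e<n = refl

r-above : ∀ {n e} → 2 ℕ.* n < e → r n e ≡ + 0
r-above {n} 2n<e rewrite cmp-lt (ℕP.≤-<-trans (ℕP.m≤n*m n 2) 2n<e) | cmp-gt 2n<e = refl

bracket-weight : ∀ n t .{{_ : ℕ.NonZero n}} → t ≤ n → sgn (suc n) ℤ.* bracketCoeff n t ≡ r n (n ℕ.+ t)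
bracket-weight n zero _ = begin
  sgn (suc n) ℤ.* + 1          ≡⟨ ℤP.*-identityʳ (sgn (suc n)) ⟩
  sgn (suc n)                  ≡⟨ sgn-suc n ⟩
  σ (parity n)                 ≡⟨ r-value n n (cmp-eq {n} refl) (cmp-lt (n<2n n)) ⟨
  r n n                        ≡⟨ cong (r n) (ℕP.+-identityʳ n) ⟨
  r n (n ℕ.+ 0)                ∎
  where open ≡-Reasoning
bracket-weight n (suc t) t<n with suc t ≟ n
... | yes refl = begin
  sgn (suc n) ℤ.* bracketCoeff n n             ≡⟨ cong (sgn (suc n) ℤ.*_) (bracketCoeff-last t) ⟩
  sgn (suc n) ℤ.* sgn n                        ≡⟨ sign-shift n n ⟩
  σ (parity (n ℕ.+ n))
    ≡⟨ r-value n (n ℕ.+ n) (cmp-lt (ℕP.m<m+n n (ℕ.>-nonZero⁻¹ n))) (cmp-eq (twice n)) ⟨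
  r n (n ℕ.+ n)                                ∎
  where open ≡-Reasoning
... | no t+1≢n = begin
  sgn (suc n) ℤ.* bracketCoeff n (suc t)       ≡⟨ cong (sgn (suc n) ℤ.*_) (bracketCoeff-interior n t t+1≢n) ⟩
  sgn (suc n) ℤ.* ((+ 2) ℤ.* sgn (suc t))      ≡⟨ commute (sgn (suc n)) (sgn (suc t)) ⟩
  (+ 2) ℤ.* (sgn (suc n) ℤ.* sgn (suc t))      ≡⟨ cong ((+ 2) ℤ.*_) (sign-shift n (suc t)) ⟩
  (+ 2) ℤ.* σ (parity (n ℕ.+ suc t))           ≡⟨ r-value n (n ℕ.+ suc t) (cmp-lt n<e) (cmp-lt e<2n) ⟨
  r n (n ℕ.+ suc t)                            ∎
  where
  open ≡-Reasoning
  n<e : n < n ℕ.+ suc t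
  n<e = ℕP.m<m+n n ℕ.z<s
  e<2n : n ℕ.+ suc t < 2 ℕ.* n
  e<2n = subst (n ℕ.+ suc t <_) (twice n) (ℕP.+-monoʳ-< n (ℕP.≤∧≢⇒< t<n t+1≢n))
  commute : ∀ a b → a ℤ.* ((+ 2) ℤ.* b) ≡ (+ 2) ℤ.* (a ℤ.* b)
  commute = solve-∀

rhsTerm-coeff : ∀ k m → rhsTerm (suc k) m ≡ Σ< m (λ j → δ (suc k ℕ.* suc j) m (r (suc k) (suc j)))
rhsTerm-coeff k m = begin
  sgn (suc n) ℤ.* (X^ (n ℕ.* n) ⊛ bracket n) m
      ≡⟨ cong (sgn (suc n) ℤ.*_)
              (X^-⊛ (n ℕ.* n) (bracket n) m (suc n) (ℕ._* n) (bracketCoeff n) (λ j _ → bracket-coeff k j)) ⟩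
  sgn (suc n) ℤ.* Σ< (suc n) (λ t → δ m (n ℕ.* n ℕ.+ t ℕ.* n) (bracketCoeff n t))
      ≡⟨ Σ<-* (suc n) (sgn (suc n)) (λ t → δ m (n ℕ.* n ℕ.+ t ℕ.* n) (bracketCoeff n t)) ⟨
  Σ< (suc n) (λ t → sgn (suc n) ℤ.* δ m (n ℕ.* n ℕ.+ t ℕ.* n) (bracketCoeff n t))
      ≡⟨ Σ<-cong (suc n) (λ t t≤n → weighted t (ℕP.≤-pred t≤n)) ⟩
  Σ< (suc n) (λ t → ρ (k ℕ.+ t))
      ≡⟨ Σ<-window m k (suc n) below above (λ j m≤j → δ-beyondʳ {n} (r n (suc j)) m≤j) ⟨
  Σ< m ρ ∎
  where
  open ≡-Reasoning
  n : ℕ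
  n = suc k
  ρ : ℕ → ℤ
  ρ j = δ (n ℕ.* suc j) m (r n (suc j))
  expand : ∀ k t → suc k ℕ.* suc k ℕ.+ t ℕ.* suc k ≡ suc k ℕ.* suc (k ℕ.+ t)
  expand = ℕSolver.solve-∀
  weighted : ∀ t → t ≤ n → sgn (suc n) ℤ.* δ m (n ℕ.* n ℕ.+ t ℕ.* n) (bracketCoeff n t) ≡ ρ (k ℕ.+ t)
  weighted t t≤n = begin
    sgn (suc n) ℤ.* δ m (n ℕ.* n ℕ.+ t ℕ.* n) (bracketCoeff n t)   ≡⟨ when-* _ (sgn (suc n)) (bracketCoeff n t) ⟨
    δ m (n ℕ.* n ℕ.+ t ℕ.* n) (sgn (suc n) ℤ.* bracketCoeff n t)
      ≡⟨ cong (δ m (n ℕ.* n ℕ.+ t ℕ.* n)) (bracket-weight n t t≤n) ⟩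
    δ m (n ℕ.* n ℕ.+ t ℕ.* n) (r n (n ℕ.+ t))                       ≡⟨ cong (λ x → δ m x (r n (n ℕ.+ t))) (expand k t) ⟩
    δ m (n ℕ.* suc (k ℕ.+ t)) (r n (n ℕ.+ t))                       ≡⟨ δ-sym m (n ℕ.* suc (k ℕ.+ t)) (r n (n ℕ.+ t)) ⟩
    ρ (k ℕ.+ t)                                                      ∎
  below : ∀ j → j < k → ρ j ≡ + 0
  below j j<k = trans (cong (δ (n ℕ.* suc j) m) (r-below {n} (s≤s j<k))) (δ-zero (n ℕ.* suc j) m)
  above : ∀ j → k ℕ.+ suc n ≤ j → ρ j ≡ + 0
  above j le = trans (cong (δ (n ℕ.* suc j) m) (r-above {n} (s≤s (subst (_≤ j) (sym (double k)) le)))) (δ-zero (n ℕ.* suc j) m)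
    where
    double : ∀ k → 2 ℕ.* suc k ≡ k ℕ.+ suc (suc k)
    double = ℕSolver.solve-∀

rhs-coeff : ∀ m → rhs m ≡ divSum m r
rhs-coeff m = begin
  rhs m                                          ≡⟨ Σℤ≤≡Σ< m (λ k → rhsTerm (suc k) m) ⟩
  Σ< (suc m) (λ k → rhsTerm (suc k) m)           ≡⟨ Σ<-trim m (suc m) tooLarge (λ k m<k → tooLarge k (ℕP.<⇒≤ m<k)) ⟩
  Σ< m (λ k → rhsTerm (suc k) m)                 ≡⟨ Σ<-cong m (λ k _ → rhsTerm-coeff k m) ⟩
  divSum m r                                     ∎
  where
  open ≡-Reasoning
  tooLarge : ∀ k → m ≤ k → rhsTerm (suc k) m ≡ + 0
  tooLarge k m≤k = trans (rhsTerm-coeff k m) (Σ<-zero m (λ j _ → δ-beyondˡ (r (suc k) (suc j)) m≤k))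

-- for a, b ≥ 1 the comparison triple (cmp a b, cmp (2 a) b, cmp a (2 b)) records the position of b
-- relative to a/2, a and 2 a; these are its seven possible values
data Shape : Cmp → Cmp → Cmp → Set where
  2b<a   : Shape gt gt gt
  2b≡a   : Shape gt gt eq
  b<a<2b : Shape gt gt lt
  a≡b    : Shape eq gt lt
  a<b<2a : Shape lt gt lt
  b≡2a   : Shape lt eq lt
  2a<b   : Shape lt lt lt

-- a < b forces a < 2 b and b < a forces b < 2 a, so one further comparison determines the shape
shape : ∀ a b .{{_ : ℕ.NonZero a}} .{{_ : ℕ.NonZero b}} → Shape (cmp a b) (cmp (2 ℕ.* a) b) (cmp a (2 ℕ.* b))
shape a b with ℕP.<-cmp a b
... | tri< a<b _ _ rewrite cmp-lt a<b | cmp-lt (ℕP.<-≤-trans a<b (ℕP.m≤n*m b 2)) with ℕP.<-cmp (2 ℕ.* a) b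
...   | tri< less _ _    rewrite cmp-lt less    = 2a<b
...   | tri≈ _ equal _   rewrite cmp-eq equal   = b≡2a
...   | tri> _ _ greater rewrite cmp-gt greater = a<b<2a
shape a b | tri≈ _ refl _ rewrite cmp-eq {a} refl | cmp-gt (n<2n a) | cmp-lt (n<2n a) = a≡b
shape a b | tri> _ _ b<a rewrite cmp-gt b<a | cmp-gt (ℕP.<-≤-trans b<a (ℕP.m≤n*m a 2)) with ℕP.<-cmp a (2 ℕ.* b)
...   | tri< less _ _    rewrite cmp-lt less    = b<a<2b
...   | tri≈ _ equal _   rewrite cmp-eq equal   = 2b≡a
...   | tri> _ _ greater rewrite cmp-gt greater = 2b<a

-- the correction term: the factorisations (2 a, b) with b even against the factorisations (a, 2 b) with a even,
-- weighted by the sign of the comparison; its sum over factorisations vanishes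
E : ℕ → ℕ → ℤ
E a b = onEven (parity b) (signum (cmp (2 ℕ.* a) b)) ℤ.- onEven (parity a) (signum (cmp a (2 ℕ.* b)))

corrections-cancel : ∀ m → divSum m E ≡ + 0
corrections-cancel m = begin
  divSum m E                           ≡⟨ divSum-+ m EB (λ a b → - EA a b) ⟩
  divSum m EB ℤ.+ divSum m (λ a b → - EA a b)
                                       ≡⟨ cong₂ ℤ._+_ (divSum-transfer m (λ x y → signum (cmp x y))) (divSum-neg m EA) ⟩
  divSum m EA ℤ.- divSum m EA          ≡⟨ ℤP.+-inverseʳ (divSum m EA) ⟩
  + 0                                  ∎
  where
  open ≡-Reasoning
  EB EA : ℕ → ℕ → ℤ
  EB a b = onEven (parity b) (signum (cmp (2 ℕ.* a) b))
  EA a b = onEven (parity a) (signum (cmp a (2 ℕ.* b)))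

Λ-sym : Parity → Parity → Cmp → Cmp → Cmp → ℤ
Λ-sym pa pb c₁ c₂ c₃ = (Fw c₃ pa 0ℙ ℤ.+ Fw c₂ 0ℙ pb ℤ.- (+ 2) ℤ.* Fw c₁ pa pb)
                       ℤ.+ (Fw (opposite c₂) pb 0ℙ ℤ.+ Fw (opposite c₃) 0ℙ pa ℤ.- (+ 2) ℤ.* Fw (opposite c₁) pb pa)

rE-sym : Parity → Parity → Cmp → Cmp → Cmp → ℤ
rE-sym pa pb c₁ c₂ c₃ = rw c₁ (opposite c₂) pb ℤ.+ rw (opposite c₁) c₃ pa
                        ℤ.+ (onEven pb (signum c₂) ℤ.- onEven pa (signum c₃))

pair-table : ∀ pa pb {c₁ c₂ c₃} → Shape c₁ c₂ c₃ → Λ-sym pa pb c₁ c₂ c₃ ≡ rE-sym pa pb c₁ c₂ c₃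
pair-table 0ℙ 0ℙ 2b<a   = refl
pair-table 0ℙ 0ℙ 2b≡a   = refl
pair-table 0ℙ 0ℙ b<a<2b = refl
pair-table 0ℙ 0ℙ a≡b    = refl
pair-table 0ℙ 0ℙ a<b<2a = refl
pair-table 0ℙ 0ℙ b≡2a   = refl
pair-table 0ℙ 0ℙ 2a<b   = refl
pair-table 0ℙ 1ℙ 2b<a   = refl
pair-table 0ℙ 1ℙ 2b≡a   = refl
pair-table 0ℙ 1ℙ b<a<2b = refl
pair-table 0ℙ 1ℙ a≡b    = refl
pair-table 0ℙ 1ℙ a<b<2a = refl
pair-table 0ℙ 1ℙ b≡2a   = refl
pair-table 0ℙ 1ℙ 2a<b   = refl
pair-table 1ℙ 0ℙ 2b<a   = refl
pair-table 1ℙ 0ℙ 2b≡a   = refl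
pair-table 1ℙ 0ℙ b<a<2b = refl
pair-table 1ℙ 0ℙ a≡b    = refl
pair-table 1ℙ 0ℙ a<b<2a = refl
pair-table 1ℙ 0ℙ b≡2a   = refl
pair-table 1ℙ 0ℙ 2a<b   = refl
pair-table 1ℙ 1ℙ 2b<a   = refl
pair-table 1ℙ 1ℙ 2b≡a   = refl
pair-table 1ℙ 1ℙ b<a<2b = refl
pair-table 1ℙ 1ℙ a≡b    = refl
pair-table 1ℙ 1ℙ a<b<2a = refl
pair-table 1ℙ 1ℙ b≡2a   = refl
pair-table 1ℙ 1ℙ 2a<b   = refl

pair-identity : ∀ a b .{{_ : ℕ.NonZero a}} .{{_ : ℕ.NonZero b}} → Λ a b ℤ.+ Λ b a ≡ r a b ℤ.+ r b a ℤ.+ E a b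
pair-identity a b rewrite parity-even a | parity-even b | cmp-flip a b | cmp-flip (2 ℕ.* a) b | cmp-flip a (2 ℕ.* b)
  = pair-table (parity a) (parity b) (shape a b)

halve : ∀ x y → x ℤ.+ x ≡ y ℤ.+ y → x ≡ y
halve x y x+x≡y+y = ℤP.*-cancelˡ-≡ (+ 2) x y (trans (double x) (trans x+x≡y+y (sym (double y))))
  where
  double : ∀ x → (+ 2) ℤ.* x ≡ x ℤ.+ x
  double = solve-∀

-- Σ_{ab=m} Λ a b = Σ_{ab=m} r a b: symmetrise in (a, b) and apply the pairwise identity
key : ∀ m → divSum m Λ ≡ divSum m r
key m = halve (divSum m Λ) (divSum m r) (begin
  divSum m Λ ℤ.+ divSum m Λ                           ≡⟨ cong (λ s → divSum m Λ ℤ.+ s) (divSum-swap m Λ) ⟩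
  divSum m Λ ℤ.+ divSum m (λ a b → Λ b a)             ≡⟨ divSum-+ m Λ (λ a b → Λ b a) ⟨
  divSum m (λ a b → Λ a b ℤ.+ Λ b a)
    ≡⟨ divSum-cong m (λ a b → Λ a b ℤ.+ Λ b a) rE (λ i j _ → pair-identity (suc i) (suc j)) ⟩
  divSum m rE                                         ≡⟨ divSum-+ m (λ a b → r a b ℤ.+ r b a) E ⟩
  divSum m (λ a b → r a b ℤ.+ r b a) ℤ.+ divSum m E   ≡⟨ cong₂ ℤ._+_ (divSum-+ m r (λ a b → r b a)) (corrections-cancel m) ⟩
  divSum m r ℤ.+ divSum m (λ a b → r b a) ℤ.+ + 0     ≡⟨ ℤP.+-identityʳ _ ⟩
  divSum m r ℤ.+ divSum m (λ a b → r b a)             ≡⟨ cong (λ s → divSum m r ℤ.+ s) (divSum-swap m r) ⟨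
  divSum m r ℤ.+ divSum m r                           ∎)
  where
  open ≡-Reasoning
  rE : ℕ → ℕ → ℤ
  rE a b = r a b ℤ.+ r b a ℤ.+ E a b

lemma2p3 : h ⊖ (+ 2) · sub2 h ≈ rhs
lemma2p3 m = begin
  (h ⊖ (+ 2) · sub2 h) m    ≡⟨ lhs-coeff m ⟩
  divSum m Λ                ≡⟨ key m ⟩
  divSum m r                ≡⟨ rhs-coeff m ⟨
  rhs m                     ∎
  where open ≡-Reasoning
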